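{- Let $\mathbf A$ be an sp-orthomodular lattice and let $x,y\in\mathrm{Sh}(\mathbf A)$ commute in the orthomodular poset $\mathbf{Sh}(\mathbf A)$. Then the infimum of $x$ and $y$ in $\mathbf{Sh}(\mathbf A)$ equals $x\land y$ computed in $\mathbf A$.
   Context: A pseudo-Kleene lattice is a bounded lattice with antitone involution ${}'$ satisfying $x\land x'\leq y\lor y'$; it is sp-orthomodular if for all $x,y$: (SP1) $x\leq y$ and $x'\land y=(x\land x')\lor(y\land y')$ imply $y\land(x\lor x')=x\lor(y\land y')$; (SP2) $x\leq y$ implies $(x\land x')\lor(y\land y')=(x'\land y)\land(x'\land y)'$. $\mathrm{Sh}(\mathbf A)=\{x: x\land x'=0\}$, and $\mathbf{Sh}(\mathbf A)=(\mathrm{Sh}(\mathbf A),\leq,{}',0,1)$ with inherited order and involution (an orthomodular poset). Elements $x,y$ of $\mathbf{Sh}(\mathbf A)$ commute in $\mathbf{Sh}(\mathbf A)$ if the infima of $\{x,y\}$ and of $\{x,y'\}$ exist in the poset $\mathrm{Sh}(\mathbf A)$ and $x$ equals the supremum, in $\mathrm{Sh}(\mathbf A)$, of these two infima. -}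

module Defs where

open import Level using (Level; _⊔_; suc)
open import Data.Product using (Σ; _×_)
open import Relation.Binary.Lattice.Bundles using (BoundedLattice)

record PseudoKleeneLattice (c ℓ₁ ℓ₂ : Level) : Set (suc (c ⊔ ℓ₁ ⊔ ℓ₂)) where
  field
    boundedLattice : BoundedLattice c ℓ₁ ℓ₂
  open BoundedLattice boundedLattice public
  field
    _′        : Carrier → Carrier
    involutive : ∀ x → ((x ′) ′) ≈ x
    antitone   : ∀ {x y} → x ≤ y → (y ′) ≤ (x ′)
    kleene     : ∀ x y → (x ∧ (x ′)) ≤ (y ∨ (y ′))

  Sh : Carrier → Set ℓ₁
  Sh x = (x ∧ (x ′)) ≈ ⊥

  IsInfSh : Carrier → Carrier → Carrier → Set (c ⊔ ℓ₁ ⊔ ℓ₂)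
  IsInfSh x y m = Sh m × m ≤ x × m ≤ y
                × (∀ z → Sh z → z ≤ x → z ≤ y → z ≤ m)

  IsSupSh : Carrier → Carrier → Carrier → Set (c ⊔ ℓ₁ ⊔ ℓ₂)
  IsSupSh a b s = Sh s × a ≤ s × b ≤ s
                × (∀ z → Sh z → a ≤ z → b ≤ z → s ≤ z)

  CommuteSh : Carrier → Carrier → Set (c ⊔ ℓ₁ ⊔ ℓ₂)
  CommuteSh x y = Σ Carrier λ m₁ → Σ Carrier λ m₂ →
                    IsInfSh x y m₁ × IsInfSh x (y ′) m₂ × IsSupSh m₁ m₂ x

record SpOrthomodularLattice (c ℓ₁ ℓ₂ : Level) : Set (suc (c ⊔ ℓ₁ ⊔ ℓ₂)) where
  field
    pkl : PseudoKleeneLattice c ℓ₁ ℓ₂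
  open PseudoKleeneLattice pkl public
  field
    SP1 : ∀ {x y} → x ≤ y
        → ((x ′) ∧ y) ≈ ((x ∧ (x ′)) ∨ (y ∧ (y ′)))
        → (y ∧ (x ∨ (x ′))) ≈ (x ∨ (y ∧ (y ′)))
    SP2 : ∀ {x y} → x ≤ y
        → ((x ∧ (x ′)) ∨ (y ∧ (y ′))) ≈ (((x ′) ∧ y) ∧ (((x ′) ∧ y) ′))

{-# OPTIONS --safe #-}
module Submission where

-- Inside Sh(A), sp-orthomodularity makes u′ ∧ v the relative complement of u
-- in v (SP2) and forces v ≤ u once that complement vanishes (SP1). Now let
-- m₁, m₂ be the Sh-infima of {x, y} and {x, y′}; they are orthogonal and x is
-- their Sh-supremum. The sharp element m₂′ ∧ m₁′ ∧ x lies below x, yet its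
-- complement is a sharp upper bound of m₁ and m₂, hence above x; so it is ⊥.
-- By SP1 this gives m₂′ ∧ x ≤ m₁, and x ∧ y ≤ m₂′ ∧ x because y ≤ m₂′.
-- Thus x ∧ y ≤ m₁, and m₁ lies below every Sh-infimum of {x, y}.

open import Level using (Level)
open import Data.Product using (_,_)
open import Defs

module PseudoKleeneProperties {c ℓ₁ ℓ₂ : Level} (A : PseudoKleeneLattice c ℓ₁ ℓ₂) where
  open PseudoKleeneLattice A

  antitone-swap : ∀ {a b} → b ≤ (a ′) → a ≤ (b ′)
  antitone-swap b≤a′ = trans (reflexive (Eq.sym (involutive _))) (antitone b≤a′)

  Sh-intro : ∀ {u} → (u ∧ (u ′)) ≤ ⊥ → Sh u
  Sh-intro u∧u′≤⊥ = antisym u∧u′≤⊥ (minimum _)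

  Sh-self-orthogonal : ∀ {u} → Sh u → u ≤ (u ′) → u ≤ ⊥
  Sh-self-orthogonal sh u≤u′ = trans (∧-greatest refl u≤u′) (reflexive sh)

  ⊤≤⊥′ : ⊤ ≤ (⊥ ′)
  ⊤≤⊥′ = antitone-swap (minimum (⊤ ′))

  Sh⇒⊤≤∨′ : ∀ {u} → Sh u → ⊤ ≤ (u ∨ (u ′))
  Sh⇒⊤≤∨′ {u} sh = trans ⊤≤⊥′ (trans (antitone [u∨u′]′≤⊥) (reflexive (involutive _)))
    where
      [u∨u′]′≤⊥ : ((u ∨ (u ′)) ′) ≤ ⊥
      [u∨u′]′≤⊥ = trans (∧-greatest (trans (antitone (y≤x∨y u (u ′))) (reflexive (involutive u)))
                                     (antitone (x≤x∨y u (u ′))))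
                        (reflexive sh)

module SpOrthomodularProperties {c ℓ₁ ℓ₂ : Level} (A : SpOrthomodularLattice c ℓ₁ ℓ₂) where
  open SpOrthomodularLattice A
  open PseudoKleeneProperties pkl

  Sh-relativeComplement : ∀ {u v} → u ≤ v → Sh u → Sh v → Sh ((u ′) ∧ v)
  Sh-relativeComplement u≤v shu shv =
    Sh-intro (trans (reflexive (Eq.sym (SP2 u≤v))) (∨-least (reflexive shu) (reflexive shv)))

  Sh-orthomodular : ∀ {u v} → u ≤ v → Sh u → Sh v → ((u ′) ∧ v) ≤ ⊥ → v ≤ u
  Sh-orthomodular {u} {v} u≤v shu shv u′∧v≤⊥ =
    trans (∧-greatest refl (trans (maximum v) (Sh⇒⊤≤∨′ shu)))
          (trans (reflexive (SP1 u≤v u′∧v≈sharpParts))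
                 (∨-least refl (trans (reflexive shv) (minimum u))))
    where
      u′∧v≈sharpParts : ((u ′) ∧ v) ≈ ((u ∧ (u ′)) ∨ (v ∧ (v ′)))
      u′∧v≈sharpParts = antisym (trans u′∧v≤⊥ (minimum _))
                                (trans (∨-least (reflexive shu) (reflexive shv)) (minimum _))

  module _ {a b s : Carrier} (sha : Sh a) (shb : Sh b) (b≤a′ : b ≤ (a ′))
           (sup : IsSupSh a b s) where
    private
      shs = let (shs , _) = sup in shs
      a≤s = let (_ , a≤s , _) = sup in a≤s
      b≤s = let (_ , _ , b≤s , _) = sup in b≤s
      least = let (_ , _ , _ , least) = sup in least

    IsSupSh-orthogonal-residual≤⊥ : ((b ′) ∧ ((a ′) ∧ s)) ≤ ⊥
    IsSupSh-orthogonal-residual≤⊥ = Sh-self-orthogonal shr (trans r≤s s≤r′)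
      where
        r = (b ′) ∧ ((a ′) ∧ s)
        shr : Sh r
        shr = Sh-relativeComplement (∧-greatest b≤a′ b≤s) shb
                (Sh-relativeComplement a≤s sha shs)
        r≤s : r ≤ s
        r≤s = trans (x∧y≤y _ _) (x∧y≤y _ _)
        s≤r′ : s ≤ (r ′)
        s≤r′ = trans (least ((r ′) ∧ s) (Sh-relativeComplement r≤s shr shs)
                       (∧-greatest (antitone-swap (trans (x∧y≤y _ _) (x∧y≤x _ _))) a≤s)
                       (∧-greatest (antitone-swap (x∧y≤x _ _)) b≤s))
                     (x∧y≤x _ _)

    IsSupSh-orthogonal-complement : ((b ′) ∧ s) ≤ a
    IsSupSh-orthogonal-complement =
      Sh-orthomodular (∧-greatest (antitone-swap b≤a′) a≤s) sha
        (Sh-relativeComplement b≤s shb shs)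
        (trans (∧-greatest (trans (x∧y≤y _ _) (x∧y≤x _ _))
                           (∧-greatest (x∧y≤x _ _) (trans (x∧y≤y _ _) (x∧y≤y _ _))))
               IsSupSh-orthogonal-residual≤⊥)

lemma4p5 : ∀ {c ℓ₁ ℓ₂ : Level} (A : SpOrthomodularLattice c ℓ₁ ℓ₂)
    → let open SpOrthomodularLattice A in
    ∀ x y → Sh x → Sh y → CommuteSh x y
    → ∀ m → IsInfSh x y m → m ≈ (x ∧ y)
lemma4p5 A x y _ _ (m₁ , m₂ , (shm₁ , m₁≤x , m₁≤y , _) , (shm₂ , _ , m₂≤y′ , _) , x=m₁⊔m₂)
         m (_ , m≤x , m≤y , m-greatest) =
  antisym (∧-greatest m≤x m≤y) (trans x∧y≤m₁ (m-greatest m₁ shm₁ m₁≤x m₁≤y))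
  where
    open SpOrthomodularLattice A
    open PseudoKleeneProperties pkl
    open SpOrthomodularProperties A

    m₂≤m₁′ : m₂ ≤ (m₁ ′)
    m₂≤m₁′ = trans m₂≤y′ (antitone m₁≤y)

    x∧y≤m₂′∧x : (x ∧ y) ≤ ((m₂ ′) ∧ x)
    x∧y≤m₂′∧x = ∧-greatest (trans (x∧y≤y x y) (antitone-swap m₂≤y′)) (x∧y≤x x y)

    x∧y≤m₁ : (x ∧ y) ≤ m₁
    x∧y≤m₁ = trans x∧y≤m₂′∧x (IsSupSh-orthogonal-complement shm₁ shm₂ m₂≤m₁′ x=m₁⊔m₂)
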